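{- Let $X_1,X_2,Y$ be NUTS and $t\subseteq(|X_1|\times|X_2|)\times|Y|$. Then $t\in\mathbf{NUTS}(X_1\otimes X_2,Y)$ if and only if for all $u_1\in\mathcal T(X_1)$ and $u_2\in\mathcal T(X_2)$ one has $t\cdot(u_1\times u_2)\in\mathcal T(Y)$.
   Context: For $\mathcal T\subseteq\mathcal P(E)$, $\mathcal T^\perp=\{u'\subseteq E\mid\forall u\in\mathcal T,\ u\cap u'\neq\emptyset\}$. A NUTS is $X=(|X|,\mathcal T(X))$ with $\mathcal T(X)\subseteq\mathcal P(|X|)$ and $\mathcal T(X)=\mathcal T(X)^{\perp\perp}$; $X^\perp=(|X|,\mathcal T(X)^\perp)$, $X\otimes Y=(|X|\times|Y|,\{u\times v\mid u\in\mathcal T(X),v\in\mathcal T(Y)\}^{\perp\perp})$, $X\multimap Y=(X\otimes Y^\perp)^\perp$, $\mathbf{NUTS}(X,Y)=\mathcal T(X\multimap Y)$. For $t\subseteq E\times F$ and $u\subseteq E$, $t\cdot u=\{b\mid\exists a\in u,(a,b)\in t\}$. -}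

module Defs where

open import Level using (0ℓ)
open import Data.Product using (Σ; Σ-syntax; _×_; _,_; proj₁; proj₂)
open import Relation.Binary.PropositionalEquality using (_≡_)

Subset : Set → Set₁
Subset E = E → Set

Family : Set → Set₂
Family E = Subset E → Set₁

Meets : {E : Set} → Subset E → Subset E → Set
Meets {E} u u' = Σ[ a ∈ E ] (u a × u' a)

_^⊥ : {E : Set} → Family E → Family E
(𝒯 ^⊥) u' = ∀ u → 𝒯 u → Meets u u'

_⊆F_ : {E : Set} → Family E → Family E → Set₁
𝒯 ⊆F 𝒯' = ∀ u → 𝒯 u → 𝒯' u

_⊠_ : {E F : Set} → Subset E → Subset F → Subset (E × F)
(u ⊠ v) p = u (proj₁ p) × v (proj₂ p)

record NUTS : Set₂ where
  field
    ∣_∣ : Set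
    𝒯 : Family ∣_∣
    ⊥⊥⊆ : ((𝒯 ^⊥) ^⊥) ⊆F 𝒯
    ⊆⊥⊥ : 𝒯 ⊆F ((𝒯 ^⊥) ^⊥)
open NUTS public

⊆⊥⊥-gen : {E : Set} (𝒯 : Family E) → 𝒯 ⊆F ((𝒯 ^⊥) ^⊥)
⊆⊥⊥-gen 𝒯 u u∈ u' u'∈ with u'∈ u u∈
... | a , p , q = a , q , p

⊥⊥⊥⊆⊥ : {E : Set} (𝒯 : Family E) → (((𝒯 ^⊥) ^⊥) ^⊥) ⊆F (𝒯 ^⊥)
⊥⊥⊥⊆⊥ 𝒯 w w∈ u u∈ = w∈ u (⊆⊥⊥-gen 𝒯 u u∈)

_⊥N : NUTS → NUTS
X ⊥N = record
  { ∣_∣ = ∣ X ∣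
  ; 𝒯 = 𝒯 X ^⊥
  ; ⊥⊥⊆ = ⊥⊥⊥⊆⊥ (𝒯 X)
  ; ⊆⊥⊥ = ⊆⊥⊥-gen (𝒯 X ^⊥) }

Rects : (X Y : NUTS) → Family (∣ X ∣ × ∣ Y ∣)
Rects X Y w = Σ[ u ∈ Subset ∣ X ∣ ] Σ[ v ∈ Subset ∣ Y ∣ ]
                (𝒯 X u × 𝒯 Y v × (w ≡ (u ⊠ v)))

_⊗_ : NUTS → NUTS → NUTS
X ⊗ Y = record
  { ∣_∣ = ∣ X ∣ × ∣ Y ∣
  ; 𝒯 = (Rects X Y ^⊥) ^⊥
  ; ⊥⊥⊆ = ⊥⊥⊥⊆⊥ (Rects X Y ^⊥)
  ; ⊆⊥⊥ = ⊆⊥⊥-gen ((Rects X Y ^⊥) ^⊥) }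

_⊸_ : NUTS → NUTS → NUTS
X ⊸ Y = (X ⊗ (Y ⊥N)) ⊥N

NUTS[_,_] : (X Y : NUTS) → Family (∣ X ∣ × ∣ Y ∣)
NUTS[ X , Y ] = 𝒯 (X ⊸ Y)

_·_ : {E F : Set} → Subset (E × F) → Subset E → Subset F
(t · u) b = Σ[ a ∈ _ ] (u a × t (a , b))

-- Since 𝒯(X ⊸ Y) is a triple orthogonal, t is a morphism X ⊸ Y iff t meets every
-- u × v' with u ∈ 𝒯(X), v' ∈ 𝒯(Y)^⊥, and t meets u × v' iff v' meets t · u iff u meets
-- the preimage t⁻¹ · v'.  So if t · u ∈ 𝒯(Y) for u in a family G generating 𝒯(X), then
-- t⁻¹ · v' ∈ G^⊥ = 𝒯(X)^⊥ and hence meets every u ∈ 𝒯(X).  For X₁ ⊗ X₂ the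
-- rectangles u₁ × u₂ are such a generating family.
module Submission where

open import Defs
open import Data.Product using (Σ-syntax; _×_; _,_)
open import Function.Base using (_∘_)
open import Function.Bundles using (_⇔_; mk⇔; Equivalence)
open import Relation.Binary.PropositionalEquality using (refl)

_⁻¹·_ : {E F : Set} → Subset (E × F) → Subset F → Subset E
(t ⁻¹· v) a = Σ[ b ∈ _ ] (v b × t (a , b))

module _ {E F : Set} {t : Subset (E × F)} {u : Subset E} {v : Subset F} where

  Meets-⊠⇒Meets-· : Meets (u ⊠ v) t → Meets v (t · u)
  Meets-⊠⇒Meets-· ((a , b) , (ua , vb) , tab) = b , vb , a , ua , tab

  Meets-·⇒Meets-⁻¹· : Meets (t · u) v → Meets u (t ⁻¹· v)
  Meets-·⇒Meets-⁻¹· (b , (a , ua , tab) , vb) = a , ua , b , vb , tab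

  Meets-⁻¹·⇒Meets-⊠ : Meets u (t ⁻¹· v) → Meets (u ⊠ v) t
  Meets-⁻¹·⇒Meets-⊠ (a , ua , b , vb , tab) = (a , b) , (ua , vb) , tab

-- G generates 𝒯(X): G ⊆ 𝒯(X) ⊆ G^⊥⊥, i.e. G^⊥ = 𝒯(X)^⊥.
module _ (X Y : NUTS) (G : Family ∣ X ∣)
         (G⊆𝒯 : G ⊆F 𝒯 X) (G^⊥⊆𝒯^⊥ : (G ^⊥) ⊆F (𝒯 X ^⊥)) where

  NUTS[,]⇔·-preserves-generators : (t : Subset (∣ X ∣ × ∣ Y ∣)) →
    NUTS[ X , Y ] t ⇔ (∀ u → G u → 𝒯 Y (t · u))
  NUTS[,]⇔·-preserves-generators t =
    mk⇔ (preserves ∘ ⊥⊥⊥⊆⊥ _ t) (⊆⊥⊥-gen _ t ∘ meets-rectangles)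
    where
    preserves : (Rects X (Y ⊥N) ^⊥) t → ∀ u → G u → 𝒯 Y (t · u)
    preserves t⊥ u u∈G = ⊥⊥⊆ Y _ λ v' v'∈𝒯^⊥ →
      Meets-⊠⇒Meets-· (t⊥ _ (u , v' , G⊆𝒯 u u∈G , v'∈𝒯^⊥ , refl))

    meets-rectangles : (∀ u → G u → 𝒯 Y (t · u)) → (Rects X (Y ⊥N) ^⊥) t
    meets-rectangles H _ (u , v' , u∈𝒯 , v'∈𝒯^⊥ , refl) =
      Meets-⁻¹·⇒Meets-⊠ (preimage∈𝒯^⊥ u u∈𝒯)
      where
      preimage∈𝒯^⊥ : (𝒯 X ^⊥) (t ⁻¹· v')
      preimage∈𝒯^⊥ = G^⊥⊆𝒯^⊥ _ λ u₀ u₀∈G →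
        Meets-·⇒Meets-⁻¹· (v'∈𝒯^⊥ _ (H u₀ u₀∈G))

lemma4p5 : (X₁ X₂ Y : NUTS) (t : Subset ((∣ X₁ ∣ × ∣ X₂ ∣) × ∣ Y ∣)) →
    NUTS[ X₁ ⊗ X₂ , Y ] t ⇔
    (∀ u₁ u₂ → 𝒯 X₁ u₁ → 𝒯 X₂ u₂ → 𝒯 Y (t · (u₁ ⊠ u₂)))
lemma4p5 X₁ X₂ Y t = mk⇔
  (λ t∈ u₁ u₂ u₁∈ u₂∈ → to t∈ _ (u₁ , u₂ , u₁∈ , u₂∈ , refl))
  (λ H → from λ { _ (u₁ , u₂ , u₁∈ , u₂∈ , refl) → H u₁ u₂ u₁∈ u₂∈ })
  where
  open Equivalence
    (NUTS[,]⇔·-preserves-generators (X₁ ⊗ X₂) Y (Rects X₁ X₂)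
      (⊆⊥⊥-gen _) (⊆⊥⊥-gen _) t)
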